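{- Let $(M,*)$ be a magma and let $GSF(2,M)$ denote the set of all functions $\{0,1\}^2\to M$. For $i\in\{1,2\}$ let $A(i):GSF(2,M)\to GSF(2,M)$ be the abstraction with respect to $*$, i.e. $A(i)(f)(b_1,b_2)=f(b)|_{b_i=0} * f(b)|_{b_i=1}$ (the value of $f$ with the $i$-th argument set to $0$, combined via $*$ with the value of $f$ with the $i$-th argument set to $1$, other argument unchanged). Then: (1) A function $f\in GSF(2,M)$ satisfies $A(1)\circ A(2)(f)=A(2)\circ A(1)(f)$ if and only if $(f(0,0)*f(1,0))*(f(0,1)*f(1,1))=(f(0,0)*f(0,1))*(f(1,0)*f(1,1))$. (2) Every $f\in GSF(2,M)$ satisfies $A(1)\circ A(2)(f)=A(2)\circ A(1)(f)$ if and only if $(a*b)*(c*d)=(a*c)*(b*d)$ for all $a,b,c,d\in M$.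
   Context: A magma $(M,*)$ is a set $M$ with a binary operation $*:M\times M\to M$ (no axioms). For $n\in\mathbb{N}$, $GSF(n,M)$ is the set of all functions $\{0,1\}^n\to M$. For $i\in\{1,\dots,n\}$ the abstraction $A(i):GSF(n,M)\to GSF(n,M)$ is defined by $A(i)(f)(b_1,\dots,b_n)=f(b_1,\dots,b_{i-1},0,b_{i+1},\dots,b_n)*f(b_1,\dots,b_{i-1},1,b_{i+1},\dots,b_n)$. -}

module Defs where

open import Data.Bool using (Bool; false; true)
open import Data.Nat using (ℕ)
open import Data.Fin using (Fin)
open import Data.Vec using (Vec; _[_]≔_)
open import Relation.Binary.PropositionalEquality using (_≡_)

-- GSF(n,M): all functions {0,1}^n → M  (0 = false, 1 = true)
GSF : ℕ → Set → Set
GSF n M = Vec Bool n → M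

-- Abstraction A(i) with respect to the magma operation _*_ (index i : Fin n, 0-based)
-- A(i)(f)(b) = f(b with b_i := 0) * f(b with b_i := 1)
A : {M : Set} → (M → M → M) → {n : ℕ} → Fin n → GSF n M → GSF n M
A _*_ i f b = f (b [ i ]≔ false) * f (b [ i ]≔ true)

_≐_ : {M : Set} {n : ℕ} → GSF n M → GSF n M → Set
g ≐ h = ∀ b → g b ≡ h b

-- Both A(1)∘A(2) and A(2)∘A(1) send f to a constant function: the four corner values
-- of f combined by pairing along one coordinate, respectively along the other. So
-- commutation at f is a single equation between corner values, and since the corner
-- values of f can be arbitrary, commutation for every f is the medial law.
module Submission where

open import Defs
open import Data.Bool using (Bool; false; true)
open import Data.Fin using (Fin; zero; suc)
open import Data.Vec using (Vec; []; _∷_)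
open import Data.Product using (_×_; _,_)
open import Function using (_∘_)
open import Relation.Binary.PropositionalEquality using (_≡_; refl; sym; trans)

module _ {M : Set} (_*_ : M → M → M) where

  Commute : GSF 2 M → Set
  Commute f = (A _*_ zero ∘ A _*_ (suc zero)) f ≐ (A _*_ (suc zero) ∘ A _*_ zero) f

  Medial : Set
  Medial = ∀ a b c d → (a * b) * (c * d) ≡ (a * c) * (b * d)

  pairedAlong₀ : GSF 2 M → M
  pairedAlong₀ f = (f (false ∷ false ∷ []) * f (true ∷ false ∷ []))
                 * (f (false ∷ true ∷ []) * f (true ∷ true ∷ []))

  pairedAlong₁ : GSF 2 M → M
  pairedAlong₁ f = (f (false ∷ false ∷ []) * f (false ∷ true ∷ []))
                 * (f (true ∷ false ∷ []) * f (true ∷ true ∷ []))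

  A₀∘A₁-constant : (f : GSF 2 M) (b : Vec Bool 2) →
                   (A _*_ zero ∘ A _*_ (suc zero)) f b ≡ pairedAlong₁ f
  A₀∘A₁-constant f (_ ∷ _ ∷ []) = refl

  A₁∘A₀-constant : (f : GSF 2 M) (b : Vec Bool 2) →
                   (A _*_ (suc zero) ∘ A _*_ zero) f b ≡ pairedAlong₀ f
  A₁∘A₀-constant f (_ ∷ _ ∷ []) = refl

  commute⇒paired≡ : (f : GSF 2 M) → Commute f → pairedAlong₀ f ≡ pairedAlong₁ f
  commute⇒paired≡ f comm = sym (comm (false ∷ false ∷ []))

  paired≡⇒commute : (f : GSF 2 M) → pairedAlong₀ f ≡ pairedAlong₁ f → Commute f
  paired≡⇒commute f eq b =
    trans (A₀∘A₁-constant f b) (trans (sym eq) (sym (A₁∘A₀-constant f b)))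

  corners : M → M → M → M → GSF 2 M
  corners a b c d (false ∷ false ∷ []) = a
  corners a b c d (true  ∷ false ∷ []) = b
  corners a b c d (false ∷ true  ∷ []) = c
  corners a b c d (true  ∷ true  ∷ []) = d

  allCommute⇒medial : (∀ f → Commute f) → Medial
  allCommute⇒medial comm a b c d = commute⇒paired≡ (corners a b c d) (comm (corners a b c d))

  medial⇒allCommute : Medial → ∀ f → Commute f
  medial⇒allCommute medial f = paired≡⇒commute f (medial _ _ _ _)

lemma1 : (M : Set) (_*_ : M → M → M) →
    ((f : GSF 2 M) →
      ((A _*_ zero ∘ A _*_ (suc zero)) f ≐ (A _*_ (suc zero) ∘ A _*_ zero) f
        → (f (false ∷ false ∷ []) * f (true ∷ false ∷ [])) * (f (false ∷ true ∷ []) * f (true ∷ true ∷ []))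
          ≡ (f (false ∷ false ∷ []) * f (false ∷ true ∷ [])) * (f (true ∷ false ∷ []) * f (true ∷ true ∷ [])))
      × ((f (false ∷ false ∷ []) * f (true ∷ false ∷ [])) * (f (false ∷ true ∷ []) * f (true ∷ true ∷ []))
          ≡ (f (false ∷ false ∷ []) * f (false ∷ true ∷ [])) * (f (true ∷ false ∷ []) * f (true ∷ true ∷ []))
        → (A _*_ zero ∘ A _*_ (suc zero)) f ≐ (A _*_ (suc zero) ∘ A _*_ zero) f))
    × (((f : GSF 2 M) → (A _*_ zero ∘ A _*_ (suc zero)) f ≐ (A _*_ (suc zero) ∘ A _*_ zero) f)
        → ∀ a b c d → (a * b) * (c * d) ≡ (a * c) * (b * d))
    × ((∀ a b c d → (a * b) * (c * d) ≡ (a * c) * (b * d))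
        → (f : GSF 2 M) → (A _*_ zero ∘ A _*_ (suc zero)) f ≐ (A _*_ (suc zero) ∘ A _*_ zero) f)
lemma1 M _*_ =
    (λ f → commute⇒paired≡ _*_ f , paired≡⇒commute _*_ f)
  , allCommute⇒medial _*_
  , medial⇒allCommute _*_
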